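{- Let $M=(E,\mathcal{B})$ be a binary matroid given by its set of bases, and let $F\in\mathcal{B}$ be such that every basis $F'\in\mathcal{B}$ has length at most $2$ with respect to $F$. Then there is a finite sequence of handle slides sending $M$ to a matroid whose set of bases consists of a single set.
   Context: $\Delta$ denotes symmetric difference. For bases $F,F'$ of a matroid, $F'$ can be written as $F'=F\Delta\{x_1,y_1\}\Delta\cdots\Delta\{x_p,y_p\}$ with distinct $x_i\in F$ and distinct $y_i\notin F$; the number $p$ ($=|F\setminus F'|$) is the length of $F'$ with respect to $F$. Handle slides: for a set system $D=(E,\mathcal{F})$ and $a,b\in E$ with $a\neq b$, $D_{ab}=(E,\mathcal{F}_{ab})$ where $\mathcal{F}_{ab}=\mathcal{F}\,\Delta\,\{X\cup\{a\} : X\subseteq E\setminus\{a,b\},\ X\cup\{b\}\in\mathcal{F}\}$; the move $D\mapsto D_{ab}$ is the handle slide of $a$ over $b$. A matroid is viewed as the set system $(E,\mathcal{B})$ of its bases. -}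

module Defs where

open import Data.Nat using (ℕ; zero; suc)
open import Data.Bool using (Bool; true; false; not; _∧_; _xor_)
open import Data.Fin using (Fin; zero; suc)
open import Data.Fin.Subset using (Subset; _⊆_; ⊥; _─_; ∣_∣)
open import Data.Vec using (Vec; []; _∷_; lookup; replicate; zipWith; _[_]≔_)
open import Data.Product using (Σ; ∃; _×_; _,_)
open import Data.List using (List; foldl)
open import Relation.Binary.PropositionalEquality using (_≡_; _≢_)
open import Function.Bundles using (_⇔_)

SetSystem : ℕ → Set
SetSystem n = Subset n → Bool

GF2Vec : ℕ → Set
GF2Vec k = Vec Bool k

zeroVec : ∀ {k} → GF2Vec k
zeroVec = replicate _ false

_⊕_ : ∀ {k} → GF2Vec k → GF2Vec k → GF2Vec k
_⊕_ = zipWith _xor_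

sumCols : ∀ {n k} → (Fin n → GF2Vec k) → Subset n → GF2Vec k
sumCols {zero}  A []            = zeroVec
sumCols {suc n} A (true  ∷ Y) = A zero ⊕ sumCols (λ i → A (suc i)) Y
sumCols {suc n} A (false ∷ Y) = sumCols (λ i → A (suc i)) Y

Independent : ∀ {n k} → (Fin n → GF2Vec k) → Subset n → Set
Independent A X = ∀ Y → Y ⊆ X → sumCols A Y ≡ zeroVec → Y ≡ ⊥

Spanning : ∀ {n k} → (Fin n → GF2Vec k) → Subset n → Set
Spanning A X = ∀ e → ∃ λ Y → Y ⊆ X × sumCols A Y ≡ A e

IsColumnBasis : ∀ {n k} → (Fin n → GF2Vec k) → Subset n → Set
IsColumnBasis A X = Independent A X × Spanning A X

-- (E, B) is a binary matroid given by its bases: it is the vector matroid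
-- of some matrix over GF(2) (columns A e, e ∈ E).
IsBinaryMatroid : ∀ {n} → SetSystem n → Set
IsBinaryMatroid {n} B =
  Σ ℕ λ k → Σ (Fin n → GF2Vec k) λ A →
    ∀ X → (B X ≡ true) ⇔ IsColumnBasis A X

lengthWrt : ∀ {n} → Subset n → Subset n → ℕ
lengthWrt F F' = ∣ F ─ F' ∣

-- Handle slide of a over b:
--   F_ab = F Δ { X ∪ {a} : X ⊆ E \ {a,b}, X ∪ {b} ∈ F }.
-- Y is in the second family iff a ∈ Y, b ∉ Y and (Y \ {a}) ∪ {b} ∈ F.
handleSlide : ∀ {n} → SetSystem n → Fin n → Fin n → SetSystem n
handleSlide B a b Y =
  B Y xor (lookup Y a ∧ not (lookup Y b) ∧ B ((Y [ a ]≔ false) [ b ]≔ true))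

Slide : ℕ → Set
Slide n = Σ (Fin n × Fin n) λ { (a , b) → a ≢ b }

applySlide : ∀ {n} → SetSystem n → Slide n → SetSystem n
applySlide B ((a , b) , _) = handleSlide B a b

applySlides : ∀ {n} → SetSystem n → List (Slide n) → SetSystem n
applySlides = foldl applySlide

SingleSet : ∀ {n} → SetSystem n → Set
SingleSet {n} B = Σ (Subset n) λ S → ∀ X → (B X ≡ true) ⇔ (X ≡ S)

-- Over GF(2) the handle slide of a over b is the column operation A a := A a + A b on a
-- representing matrix A. Take X with a ∈ X, b ∉ X and put Z = X - a: X, Z + b, and X after
-- the operation are bases exactly when A a, A b, resp. A a + A b complete the columns of Z
-- to a basis. If some vector completes Z, then span Z is a hyperplane of the column space
-- and the completing vectors are exactly those outside it, so A a + A b completes Z iff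
-- exactly one of A a, A b does: this is the symmetric difference in the definition of the
-- slide. If a ∉ X, or a, b ∈ X, the operation does not change whether X is a basis.
-- Finally, sliding each e ∉ F over the elements of F that express A e clears column e,
-- after which F is the only basis.

module Submission where

open import Defs
open import Data.Nat using (ℕ; zero; suc; _≤_)
open import Data.Bool using (Bool; true; false; _xor_)
open import Data.Bool.Properties using (xor-assoc; xor-comm; xor-identityˡ; xor-identityʳ; xor-same) renaming (_≟_ to _≟ᵇ_)
open import Data.Empty using (⊥-elim)
open import Data.Fin using (Fin; zero; suc; _≟_)
open import Data.Fin.Subset using (Subset; _∈_; _∉_; _⊆_; ⊥; ⁅_⁆)
open import Data.Fin.Subset.Properties using (_∈?_; _⊆?_; ⊆-antisym; ∉⊥; ⊥⊆; x∈⁅x⁆; x∈⁅y⁆⇒x≡y; anySubset?)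
open import Data.Product using (Σ; ∃; _×_; _,_; proj₁; proj₂)
open import Data.Sum using (_⊎_; inj₁; inj₂; [_,_]′; map₂)
import Data.Sum as Sum
open import Function.Properties.Equivalence using (⇔-setoid) renaming (trans to ⇔-trans)
import Relation.Binary.Reasoning.Setoid as SetoidReasoning
open import Level using (0ℓ)
open import Function using (id; _∘_; _⇔_; mk⇔; Equivalence)
open import Data.List using (List; []; _∷_; _++_; foldl; foldr; allFin)
import Data.List as List
open import Data.List.Properties using (foldl-++; foldr-map)
open import Data.List.Relation.Unary.All using (All; []; _∷_)
import Data.List.Relation.Unary.All as All
import Data.List.Relation.Unary.All.Properties as All
open import Data.List.Relation.Unary.Any using (here; there)
open import Data.List.Membership.Propositional using () renaming (_∈_ to _∈ˡ_)
open import Data.List.Membership.Propositional.Properties using (∈-allFin)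
open import Data.Vec using ([]; _∷_; here; there; lookup; zipWith; _[_]≔_)
open import Data.Vec.Properties using ([]=-injective; []≔-updates; []≔-minimal; []=⇒lookup; lookup⇒[]=; lookup∘update′; lookup-zipWith; []≔-idempotent; []≔-lookup; ≡-dec)
open import Data.Vec.Functional using (updateAt)
open import Data.Vec.Functional.Properties using (updateAt-updates; updateAt-minimal; updateAt-id; updateAt-id-local; updateAt-updateAt-local; updateAt-cong-local)
open import Data.Vec.Relation.Binary.Pointwise.Inductive
  using (Pointwise-≡⇒≡; zipWith-assoc; zipWith-comm; zipWith-identityˡ; zipWith-identityʳ)
open import Relation.Binary.PropositionalEquality using (_≡_; _≢_; refl; sym; trans; cong; cong₂; subst; _≗_; module ≡-Reasoning)
open import Relation.Nullary using (¬_; Dec; yes; no)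
open import Relation.Nullary.Decidable using (_×-dec_)

private
  variable
    n k : ℕ

  module ⇔-Reasoning = SetoidReasoning (⇔-setoid 0ℓ)

⊕-assoc : (x y z : GF2Vec k) → (x ⊕ y) ⊕ z ≡ x ⊕ (y ⊕ z)
⊕-assoc x y z = Pointwise-≡⇒≡ (zipWith-assoc xor-assoc x y z)

⊕-comm : (x y : GF2Vec k) → x ⊕ y ≡ y ⊕ x
⊕-comm x y = Pointwise-≡⇒≡ (zipWith-comm xor-comm x y)

⊕-identityˡ : (x : GF2Vec k) → zeroVec ⊕ x ≡ x
⊕-identityˡ x = Pointwise-≡⇒≡ (zipWith-identityˡ xor-identityˡ x)

⊕-identityʳ : (x : GF2Vec k) → x ⊕ zeroVec ≡ x
⊕-identityʳ x = Pointwise-≡⇒≡ (zipWith-identityʳ xor-identityʳ x)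

⊕-self : (x : GF2Vec k) → x ⊕ x ≡ zeroVec
⊕-self []       = refl
⊕-self (b ∷ x) = cong₂ _∷_ (xor-same b) (⊕-self x)

⊕-cancelʳ : (x y : GF2Vec k) → (x ⊕ y) ⊕ y ≡ x
⊕-cancelʳ x y = trans (⊕-assoc x y y) (trans (cong (x ⊕_) (⊕-self y)) (⊕-identityʳ x))

⊕-cancelˡ : (x y : GF2Vec k) → x ⊕ (x ⊕ y) ≡ y
⊕-cancelˡ x y = trans (sym (⊕-assoc x x y)) (trans (cong (_⊕ y) (⊕-self x)) (⊕-identityˡ y))

⊕-interchange : (a b c d : GF2Vec k) → (a ⊕ b) ⊕ (c ⊕ d) ≡ (a ⊕ c) ⊕ (b ⊕ d)
⊕-interchange a b c d = begin
  (a ⊕ b) ⊕ (c ⊕ d)   ≡⟨ ⊕-assoc a b (c ⊕ d) ⟩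
  a ⊕ (b ⊕ (c ⊕ d))   ≡⟨ cong (a ⊕_) (sym (⊕-assoc b c d)) ⟩
  a ⊕ ((b ⊕ c) ⊕ d)   ≡⟨ cong (λ t → a ⊕ (t ⊕ d)) (⊕-comm b c) ⟩
  a ⊕ ((c ⊕ b) ⊕ d)   ≡⟨ cong (a ⊕_) (⊕-assoc c b d) ⟩
  a ⊕ (c ⊕ (b ⊕ d))   ≡⟨ sym (⊕-assoc a c (b ⊕ d)) ⟩
  (a ⊕ c) ⊕ (b ⊕ d)   ∎
  where open ≡-Reasoning

⊕-moveʳ : ∀ {x y z : GF2Vec k} → x ≡ y ⊕ z → y ≡ x ⊕ z
⊕-moveʳ {y = y} {z} refl = sym (⊕-cancelʳ y z)

false≢true : false ≢ true
false≢true ()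

infixr 1 _⊻_
_⊻_ : Set → Set → Set
P ⊻ Q = (P × ¬ Q) ⊎ (¬ P × Q)

xor-true⇔ : ∀ {P Q : Set} {p q : Bool} → (p ≡ true ⇔ P) → (q ≡ true ⇔ Q) →
  (p xor q ≡ true) ⇔ (P ⊻ Q)
xor-true⇔ {p = true}  {true}  p⇔P q⇔Q = mk⇔ (λ ()) λ
  { (inj₁ (_ , ¬Q)) → ⊥-elim (¬Q (Equivalence.to q⇔Q refl))
  ; (inj₂ (¬P , _)) → ⊥-elim (¬P (Equivalence.to p⇔P refl)) }
xor-true⇔ {p = true}  {false} p⇔P q⇔Q =
  mk⇔ (λ _ → inj₁ (Equivalence.to p⇔P refl , λ Q → false≢true (Equivalence.from q⇔Q Q))) (λ _ → refl)
xor-true⇔ {p = false} {true}  p⇔P q⇔Q =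
  mk⇔ (λ _ → inj₂ ((λ P → false≢true (Equivalence.from p⇔P P)) , Equivalence.to q⇔Q refl)) (λ _ → refl)
xor-true⇔ {p = false} {false} p⇔P q⇔Q = mk⇔ (λ ()) λ
  { (inj₁ (P , _)) → ⊥-elim (false≢true (Equivalence.from p⇔P P))
  ; (inj₂ (_ , Q)) → ⊥-elim (false≢true (Equivalence.from q⇔Q Q)) }

∈-insert : (Y : Subset n) (c : Fin n) → c ∈ Y [ c ]≔ true
∈-insert = []≔-updates

∉-remove : (Y : Subset n) (c : Fin n) → c ∉ Y [ c ]≔ false
∉-remove Y c c∈ with []=-injective ([]≔-updates Y c) c∈
... | ()

∈-update⁺ : ∀ {Y : Subset n} {x c} v → x ≢ c → x ∈ Y → x ∈ Y [ c ]≔ v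
∈-update⁺ {Y = Y} {x} {c} v x≢c = []≔-minimal Y x c x≢c

∈-update⁻ : ∀ {Y : Subset n} {x c} v → x ≢ c → x ∈ Y [ c ]≔ v → x ∈ Y
∈-update⁻ {Y = Y} {x} v x≢c x∈ =
  lookup⇒[]= x Y (trans (sym (lookup∘update′ x≢c Y v)) ([]=⇒lookup x∈))

∈-xor⁻ : ∀ (Y Y′ : Subset n) {x} → x ∈ zipWith _xor_ Y Y′ → x ∈ Y ⊎ x ∈ Y′
∈-xor⁻ Y Y′ {x} x∈ with lookup Y x in eq
... | true  = inj₁ (lookup⇒[]= x Y eq)
... | false = inj₂ (lookup⇒[]= x Y′ (trans (sym (cong (_xor lookup Y′ x) eq))
                    (trans (sym (lookup-zipWith _xor_ x Y Y′)) ([]=⇒lookup x∈))))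

⊆-insert : ∀ {Z : Subset n} {c} → Z ⊆ Z [ c ]≔ true
⊆-insert {Z = Z} {c} {x} x∈Z with x ≟ c
... | yes refl = ∈-insert Z c
... | no  x≢c  = ∈-update⁺ true x≢c x∈Z

insert-⊆ : ∀ {W Z : Subset n} {c} → c ∈ Z → W ⊆ Z → W [ c ]≔ true ⊆ Z
insert-⊆ {c = c} c∈Z W⊆Z {x} x∈ with x ≟ c
... | yes refl = c∈Z
... | no  x≢c  = W⊆Z (∈-update⁻ true x≢c x∈)

module _ {W Z : Subset n} {c : Fin n} where

  insert-mono : W ⊆ Z → W [ c ]≔ true ⊆ Z [ c ]≔ true
  insert-mono W⊆Z = insert-⊆ (∈-insert Z c) (⊆-insert ∘ W⊆Z)

  ⊆-insert⁻ : W ⊆ Z [ c ]≔ true → c ∉ W → W ⊆ Z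
  ⊆-insert⁻ W⊆ c∉W {x} x∈W with x ≟ c
  ... | yes refl = ⊥-elim (c∉W x∈W)
  ... | no  x≢c  = ∈-update⁻ true x≢c (W⊆ x∈W)

  remove-⊆ : W ⊆ Z [ c ]≔ true → W [ c ]≔ false ⊆ Z
  remove-⊆ W⊆ {x} x∈ with x ≟ c
  ... | yes refl = ⊥-elim (∉-remove W c x∈)
  ... | no  x≢c  = ∈-update⁻ true x≢c (W⊆ (∈-update⁻ false x≢c x∈))

⁅⁆-⊆ : ∀ {X : Subset n} {e} → e ∈ X → ⁅ e ⁆ ⊆ X
⁅⁆-⊆ {e = e} e∈X x∈ = subst (_∈ _) (sym (x∈⁅y⁆⇒x≡y e x∈)) e∈X

insert-remove : ∀ {Y : Subset n} {c} → c ∈ Y → (Y [ c ]≔ false) [ c ]≔ true ≡ Y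
insert-remove {Y = Y} {c} c∈Y = begin
  (Y [ c ]≔ false) [ c ]≔ true   ≡⟨ []≔-idempotent Y c ⟩
  Y [ c ]≔ true                  ≡⟨ cong (Y [ c ]≔_) (sym ([]=⇒lookup c∈Y)) ⟩
  Y [ c ]≔ lookup Y c            ≡⟨ []≔-lookup Y c ⟩
  Y                              ∎
  where open ≡-Reasoning

Matrix : ℕ → ℕ → Set
Matrix n k = Fin n → GF2Vec k

sumCols-⊥ : (A : Matrix n k) → sumCols A ⊥ ≡ zeroVec
sumCols-⊥ {zero}  A = refl
sumCols-⊥ {suc n} A = sumCols-⊥ (A ∘ suc)

sumCols-cong : ∀ {A A′ : Matrix n k} (Y : Subset n) →
  (∀ {e} → e ∈ Y → A e ≡ A′ e) → sumCols A Y ≡ sumCols A′ Y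
sumCols-cong []          eq = refl
sumCols-cong (true ∷ Y)  eq = cong₂ _⊕_ (eq here) (sumCols-cong Y (λ e∈ → eq (there e∈)))
sumCols-cong (false ∷ Y) eq = sumCols-cong Y (λ e∈ → eq (there e∈))

sumCols-insert : (A : Matrix n k) (Y : Subset n) {c : Fin n} →
  c ∉ Y → sumCols A (Y [ c ]≔ true) ≡ sumCols A Y ⊕ A c
sumCols-insert A (true ∷ Y)  {zero}  c∉Y = ⊥-elim (c∉Y here)
sumCols-insert A (false ∷ Y) {zero}  c∉Y = ⊕-comm _ _
sumCols-insert A (true ∷ Y)  {suc c} c∉Y =
  trans (cong (A zero ⊕_) (sumCols-insert (A ∘ suc) Y (λ c∈ → c∉Y (there c∈))))
        (sym (⊕-assoc _ _ _))
sumCols-insert A (false ∷ Y) {suc c} c∉Y =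
  sumCols-insert (A ∘ suc) Y (λ c∈ → c∉Y (there c∈))

sumCols-remove : (A : Matrix n k) {Y : Subset n} {c : Fin n} →
  c ∈ Y → sumCols A Y ≡ sumCols A (Y [ c ]≔ false) ⊕ A c
sumCols-remove A {Y} {c} c∈Y = begin
  sumCols A Y                                ≡⟨ cong (sumCols A) (sym (insert-remove c∈Y)) ⟩
  sumCols A ((Y [ c ]≔ false) [ c ]≔ true)   ≡⟨ sumCols-insert A (Y [ c ]≔ false) (∉-remove Y c) ⟩
  sumCols A (Y [ c ]≔ false) ⊕ A c           ∎
  where open ≡-Reasoning

sumCols-xor : (A : Matrix n k) (Y Y′ : Subset n) →
  sumCols A (zipWith _xor_ Y Y′) ≡ sumCols A Y ⊕ sumCols A Y′
sumCols-xor A [] [] = sym (⊕-identityˡ zeroVec)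
sumCols-xor A (true ∷ Y) (true ∷ Y′) = begin
  sumCols A′ (zipWith _xor_ Y Y′)                 ≡⟨ sumCols-xor A′ Y Y′ ⟩
  S ⊕ S′                                          ≡⟨ sym (⊕-identityˡ (S ⊕ S′)) ⟩
  zeroVec ⊕ (S ⊕ S′)                              ≡⟨ cong (_⊕ (S ⊕ S′)) (sym (⊕-self (A zero))) ⟩
  (A zero ⊕ A zero) ⊕ (S ⊕ S′)                    ≡⟨ ⊕-interchange (A zero) (A zero) S S′ ⟩
  (A zero ⊕ S) ⊕ (A zero ⊕ S′)                    ∎
  where
  open ≡-Reasoning
  A′ = A ∘ suc
  S  = sumCols A′ Y
  S′ = sumCols A′ Y′
sumCols-xor A (true ∷ Y) (false ∷ Y′) =
  trans (cong (A zero ⊕_) (sumCols-xor (A ∘ suc) Y Y′)) (sym (⊕-assoc _ _ _))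
sumCols-xor A (false ∷ Y) (true ∷ Y′) = begin
  A zero ⊕ sumCols A′ (zipWith _xor_ Y Y′)   ≡⟨ cong (A zero ⊕_) (sumCols-xor A′ Y Y′) ⟩
  A zero ⊕ (S ⊕ S′)                         ≡⟨ sym (⊕-assoc (A zero) S S′) ⟩
  (A zero ⊕ S) ⊕ S′                         ≡⟨ cong (_⊕ S′) (⊕-comm (A zero) S) ⟩
  (S ⊕ A zero) ⊕ S′                         ≡⟨ ⊕-assoc S (A zero) S′ ⟩
  S ⊕ (A zero ⊕ S′)                         ∎
  where
  open ≡-Reasoning
  A′ = A ∘ suc
  S  = sumCols A′ Y
  S′ = sumCols A′ Y′
sumCols-xor A (false ∷ Y) (false ∷ Y′) = sumCols-xor (A ∘ suc) Y Y′

sumCols-⁅⁆ : (A : Matrix n k) (e : Fin n) → sumCols A ⁅ e ⁆ ≡ A e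
sumCols-⁅⁆ A zero    = trans (cong (A zero ⊕_) (sumCols-⊥ (A ∘ suc))) (⊕-identityʳ (A zero))
sumCols-⁅⁆ A (suc e) = sumCols-⁅⁆ (A ∘ suc) e

Span : Matrix n k → Subset n → GF2Vec k → Set
Span A Z x = ∃ λ Y → Y ⊆ Z × sumCols A Y ≡ x

SpanWith : Matrix n k → Subset n → GF2Vec k → GF2Vec k → Set
SpanWith A Z x y = Span A Z y ⊎ Span A Z (y ⊕ x)

module _ {A : Matrix n k} {Z : Subset n} where

  span-zero : Span A Z zeroVec
  span-zero = ⊥ , ⊥⊆ , sumCols-⊥ A

  span-⊕ : ∀ {x y} → Span A Z x → Span A Z y → Span A Z (x ⊕ y)
  span-⊕ (Y , Y⊆Z , refl) (Y′ , Y′⊆Z , refl) =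
    zipWith _xor_ Y Y′ , [ Y⊆Z , Y′⊆Z ]′ ∘ ∈-xor⁻ Y Y′ , sumCols-xor A Y Y′

  span-column : ∀ {e} → e ∈ Z → Span A Z (A e)
  span-column {e} e∈Z = ⁅ e ⁆ , ⁅⁆-⊆ e∈Z , sumCols-⁅⁆ A e

  span? : ∀ x → Dec (Span A Z x)
  span? x = anySubset? (λ Y → (Y ⊆? Z) ×-dec ≡-dec _≟ᵇ_ (sumCols A Y) x)

span-mono : ∀ {A : Matrix n k} {Z Z′ x} → Z ⊆ Z′ → Span A Z x → Span A Z′ x
span-mono Z⊆Z′ (Y , Y⊆Z , eq) = Y , Z⊆Z′ ∘ Y⊆Z , eq

module _ {A A′ : Matrix n k} {Z : Subset n} (agree : ∀ {e} → e ∈ Z → A e ≡ A′ e) where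

  private
    sums-agree : ∀ {Y} → Y ⊆ Z → sumCols A Y ≡ sumCols A′ Y
    sums-agree Y⊆Z = sumCols-cong _ (agree ∘ Y⊆Z)

  span-cong : ∀ {x} → Span A Z x → Span A′ Z x
  span-cong (Y , Y⊆Z , eq) = Y , Y⊆Z , trans (sym (sums-agree Y⊆Z)) eq

  independent-cong : Independent A Z → Independent A′ Z
  independent-cong ind Y Y⊆Z eq = ind Y Y⊆Z (trans (sums-agree Y⊆Z) eq)

  spanWith-cong : ∀ {x y} → SpanWith A Z x y → SpanWith A′ Z x y
  spanWith-cong = Sum.map span-cong span-cong

independent-nonzero : ∀ {A : Matrix n k} {X e} → Independent A X → e ∈ X → A e ≢ zeroVec
independent-nonzero {A = A} {e = e} ind e∈X Ae≡0 =
  ∉⊥ (subst (e ∈_) (ind ⁅ e ⁆ (⁅⁆-⊆ e∈X) (trans (sumCols-⁅⁆ A e) Ae≡0)) (x∈⁅x⁆ e))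

independent-insert⇒sumCols≢ : ∀ {A : Matrix n k} {Z W c} →
  Independent A Z → W [ c ]≔ true ⊆ Z → c ∉ W → sumCols A W ≢ A c
independent-insert⇒sumCols≢ {A = A} {W = W} {c} ind W+c⊆Z c∉W eq =
  ∉⊥ (subst (c ∈_) (ind (W [ c ]≔ true) W+c⊆Z sum≡0) (∈-insert W c))
  where
  sum≡0 = trans (sumCols-insert A W c∉W) (trans (cong (_⊕ A c) eq) (⊕-self (A c)))

spanning-⊆-independent⇒⊇ : ∀ {A : Matrix n k} {X F} → Independent A F → X ⊆ F → Spanning A X → F ⊆ X
spanning-⊆-independent⇒⊇ ind X⊆F sp {f} f∈F with sp f
... | W , W⊆X , eq with f ∈? W
...   | yes f∈W = W⊆X f∈W
...   | no  f∉W = ⊥-elim (independent-insert⇒sumCols≢ ind (insert-⊆ f∈F (X⊆F ∘ W⊆X)) f∉W eq)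

-- Adjoining one vector to an independent set

-- The columns indexed by Z together with the vector x form a basis of the column space of A.
BasisWith : Matrix n k → Subset n → GF2Vec k → Set
BasisWith A Z x = Independent A Z × ¬ Span A Z x × (∀ e → SpanWith A Z x (A e))

module _ (A : Matrix n k) {Z : Subset n} {c : Fin n} (c∉Z : c ∉ Z) where

  columnBasis-insert⇔ : IsColumnBasis A (Z [ c ]≔ true) ⇔ BasisWith A Z (A c)
  columnBasis-insert⇔ = mk⇔ to from
    where
    sum-insert : ∀ {Y} → Y ⊆ Z → sumCols A (Y [ c ]≔ true) ≡ sumCols A Y ⊕ A c
    sum-insert {Y} Y⊆Z = sumCols-insert A Y (c∉Z ∘ Y⊆Z)

    to : IsColumnBasis A (Z [ c ]≔ true) → BasisWith A Z (A c)
    to (ind , sp) = (λ Y Y⊆Z → ind Y (⊆-insert ∘ Y⊆Z)) , c∉span , λ e → split (sp e)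
      where
      c∉span : ¬ Span A Z (A c)
      c∉span (Y , Y⊆Z , eq) = independent-insert⇒sumCols≢ ind (insert-mono Y⊆Z) (c∉Z ∘ Y⊆Z) eq
      split : ∀ {x} → Span A (Z [ c ]≔ true) x → SpanWith A Z (A c) x
      split (Y , Y⊆ , eq) with c ∈? Y
      ... | yes c∈Y = inj₂ (Y [ c ]≔ false , remove-⊆ Y⊆ , ⊕-moveʳ (trans (sym eq) (sumCols-remove A c∈Y)))
      ... | no  c∉Y = inj₁ (Y , ⊆-insert⁻ Y⊆ c∉Y , eq)

    from : BasisWith A Z (A c) → IsColumnBasis A (Z [ c ]≔ true)
    from (ind , c∉span , cols) = ind′ , λ e → [ span-mono ⊆-insert , join ]′ (cols e)
      where
      ind′ : Independent A (Z [ c ]≔ true)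
      ind′ Y Y⊆ eq with c ∈? Y
      ... | yes c∈Y = ⊥-elim (c∉span (Y [ c ]≔ false , remove-⊆ Y⊆ ,
                        trans (⊕-moveʳ (trans (sym eq) (sumCols-remove A c∈Y))) (⊕-identityˡ (A c))))
      ... | no  c∉Y = ind Y (⊆-insert⁻ Y⊆ c∉Y) eq
      join : ∀ {x} → Span A Z (x ⊕ A c) → Span A (Z [ c ]≔ true) x
      join {x} (Y , Y⊆Z , eq) =
        Y [ c ]≔ true , insert-mono Y⊆Z , trans (sum-insert Y⊆Z) (trans (cong (_⊕ A c) eq) (⊕-cancelʳ x (A c)))

columnBasis-remove⇔ : ∀ (A : Matrix n k) {X c} → c ∈ X →
  IsColumnBasis A X ⇔ BasisWith A (X [ c ]≔ false) (A c)
columnBasis-remove⇔ A {X} {c} c∈X =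
  subst (λ Y → IsColumnBasis A Y ⇔ BasisWith A (X [ c ]≔ false) (A c)) (insert-remove c∈X) (columnBasis-insert⇔ A (∉-remove X c))

module _ {A : Matrix n k} {Z : Subset n} where

  basisWith-shift : ∀ {x d} → Span A Z d → BasisWith A Z x → BasisWith A Z (x ⊕ d)
  basisWith-shift {x} {d} d∈ (ind , x∉ , cols) =
    ind , (λ x⊕d∈ → x∉ (subst (Span A Z) (⊕-cancelʳ x d) (span-⊕ x⊕d∈ d∈))) , map₂ shift ∘ cols
    where
    shift : ∀ {y} → Span A Z (y ⊕ x) → Span A Z (y ⊕ (x ⊕ d))
    shift {y} s = subst (Span A Z) (⊕-assoc y x d) (span-⊕ s d∈)

  basisWith-⊕-column : ∀ {x} e → BasisWith A Z x → ¬ BasisWith A Z (A e) → BasisWith A Z (x ⊕ A e)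
  basisWith-⊕-column {x} e q ¬q with span? (A e) | proj₂ (proj₂ q) e
  ... | yes e∈ | _       = basisWith-shift e∈ q
  ... | no  e∉ | inj₁ e∈ = ⊥-elim (e∉ e∈)
  ... | no  _  | inj₂ s  =
    ⊥-elim (¬q (subst (BasisWith A Z) (trans (cong (x ⊕_) (⊕-comm (A e) x)) (⊕-cancelˡ x (A e)))
                                      (basisWith-shift s q)))

  basisWith-⊕ : ∀ a b → BasisWith A Z (A a ⊕ A b) ⇔ (BasisWith A Z (A a) ⊻ BasisWith A Z (A b))
  basisWith-⊕ a b = mk⇔ to from
    where
    to : BasisWith A Z (A a ⊕ A b) → BasisWith A Z (A a) ⊻ BasisWith A Z (A b)
    to q with span? (A a) | proj₂ (proj₂ q) a
    ... | yes a∈ | _ = inj₂ ((λ qa → proj₁ (proj₂ qa) a∈) ,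
                             subst (BasisWith A Z) (trans (cong (_⊕ A a) (⊕-comm (A a) (A b))) (⊕-cancelʳ (A b) (A a)))
                                   (basisWith-shift a∈ q))
    ... | no a∉ | inj₁ a∈ = ⊥-elim (a∉ a∈)
    ... | no _  | inj₂ s  = inj₁ (subst (BasisWith A Z) (⊕-cancelʳ (A a) (A b)) (basisWith-shift b∈ q) ,
                                  λ qb → proj₁ (proj₂ qb) b∈)
      where b∈ = subst (Span A Z) (⊕-cancelˡ (A a) (A b)) s
    from : BasisWith A Z (A a) ⊻ BasisWith A Z (A b) → BasisWith A Z (A a ⊕ A b)
    from (inj₁ (qa , ¬qb)) = basisWith-⊕-column b qa ¬qb
    from (inj₂ (¬qa , qb)) = subst (BasisWith A Z) (⊕-comm (A b) (A a)) (basisWith-⊕-column a qb ¬qa)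

-- Handle slides are column additions

addCol : Matrix n k → Fin n → Fin n → Matrix n k
addCol A a b = updateAt A a (_⊕ A b)

module _ {A : Matrix n k} {a b : Fin n} where

  addCol-self : addCol A a b a ≡ A a ⊕ A b
  addCol-self = updateAt-updates a A

  addCol-other : ∀ {e} → e ≢ a → addCol A a b e ≡ A e
  addCol-other {e} e≢a = updateAt-minimal e a A e≢a

  addCol-outside : ∀ {Z : Subset n} → a ∉ Z → ∀ {e} → e ∈ Z → A e ≡ addCol A a b e
  addCol-outside a∉Z e∈Z = sym (addCol-other λ { refl → a∉Z e∈Z })

  addCol-involutive : a ≢ b → addCol (addCol A a b) a b ≗ A
  addCol-involutive a≢b e = trans (updateAt-updateAt-local a {h = id} A (begin
    (A a ⊕ A b) ⊕ addCol A a b b   ≡⟨ cong ((A a ⊕ A b) ⊕_) (addCol-other (a≢b ∘ sym)) ⟩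
    (A a ⊕ A b) ⊕ A b              ≡⟨ ⊕-cancelʳ (A a) (A b) ⟩
    A a                            ∎) e) (updateAt-id a A e)
    where open ≡-Reasoning

addCol-cong : ∀ {A A′ : Matrix n k} {a b} → A ≗ A′ → addCol A a b ≗ addCol A′ a b
addCol-cong {A = A} {A′} {a} {b} A≗A′ e with e ≟ a
... | yes refl = trans (addCol-self {A = A}) (trans (cong₂ _⊕_ (A≗A′ a) (A≗A′ b)) (sym (addCol-self {A = A′})))
... | no  e≢a  = trans (addCol-other {A = A} e≢a) (trans (A≗A′ e) (sym (addCol-other {A = A′} e≢a)))

⊕-Closed : (GF2Vec k → Set) → Set
⊕-Closed S = ∀ {x y} → S x → S y → S (x ⊕ y)

columns-addCol⇔ : ∀ {A : Matrix n k} {a b} {S : GF2Vec k → Set} → a ≢ b → ⊕-Closed S →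
  (∀ e → S (A e)) ⇔ (∀ e → S (addCol A a b e))
columns-addCol⇔ {A = A} {a} {b} {S} a≢b closed =
  mk⇔ preserve (λ S-cols e → subst S (addCol-involutive a≢b e) (preserve S-cols e))
  where
  preserve : ∀ {C} → (∀ e → S (C e)) → ∀ e → S (addCol C a b e)
  preserve {C} S-cols e with e ≟ a
  ... | yes refl = subst S (sym (addCol-self {A = C})) (closed (S-cols a) (S-cols b))
  ... | no  e≢a  = subst S (sym (addCol-other {A = C} e≢a)) (S-cols e)

spanWith-⊕ : ∀ {A : Matrix n k} {Z x} → ⊕-Closed (SpanWith A Z x)
spanWith-⊕ {A = A} {Z} {x} {y} {y′} = λ
  { (inj₁ s) (inj₁ t) → inj₁ (span-⊕ s t)
  ; (inj₁ s) (inj₂ t) → inj₂ (subst (Span A Z) (sym (⊕-assoc y y′ x)) (span-⊕ s t))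
  ; (inj₂ s) (inj₁ t) → inj₂ (subst (Span A Z) (swap-last y x y′) (span-⊕ s t))
  ; (inj₂ s) (inj₂ t) → inj₁ (subst (Span A Z) (cancel-twice y x y′) (span-⊕ s t)) }
  where
  open ≡-Reasoning
  swap-last : ∀ u v w → (u ⊕ v) ⊕ w ≡ (u ⊕ w) ⊕ v
  swap-last u v w = begin
    (u ⊕ v) ⊕ w   ≡⟨ ⊕-assoc u v w ⟩
    u ⊕ (v ⊕ w)   ≡⟨ cong (u ⊕_) (⊕-comm v w) ⟩
    u ⊕ (w ⊕ v)   ≡⟨ sym (⊕-assoc u w v) ⟩
    (u ⊕ w) ⊕ v   ∎
  cancel-twice : ∀ u v w → (u ⊕ v) ⊕ (w ⊕ v) ≡ u ⊕ w
  cancel-twice u v w = begin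
    (u ⊕ v) ⊕ (w ⊕ v)   ≡⟨ ⊕-interchange u v w v ⟩
    (u ⊕ w) ⊕ (v ⊕ v)   ≡⟨ cong ((u ⊕ w) ⊕_) (⊕-self v) ⟩
    (u ⊕ w) ⊕ zeroVec   ≡⟨ ⊕-identityʳ (u ⊕ w) ⟩
    u ⊕ w               ∎

module _ {A : Matrix n k} {a b : Fin n} (a≢b : a ≢ b) where

  columnBasis-addCol-outside : ∀ {X} → a ∉ X → IsColumnBasis A X ⇔ IsColumnBasis (addCol A a b) X
  columnBasis-addCol-outside {X} a∉X = mk⇔
    (λ (ind , sp) → independent-cong agree ind , λ e → span-cong agree (Equivalence.to cols⇔ sp e))
    (λ (ind , sp) → independent-cong (sym ∘ agree) ind ,
                    Equivalence.from cols⇔ (λ e → span-cong (sym ∘ agree) (sp e)))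
    where
    agree : ∀ {e} → e ∈ X → A e ≡ addCol A a b e
    agree = addCol-outside {A = A} a∉X
    cols⇔ : (∀ e → Span A X (A e)) ⇔ (∀ e → Span A X (addCol A a b e))
    cols⇔ = columns-addCol⇔ {S = Span A X} a≢b span-⊕

  basisWith-addCol : ∀ {Z} → a ∉ Z → BasisWith A Z (A a ⊕ A b) ⇔ BasisWith (addCol A a b) Z (A a ⊕ A b)
  basisWith-addCol {Z} a∉Z = mk⇔
    (λ (ind , w∉ , cols) → independent-cong agree ind , w∉ ∘ span-cong (sym ∘ agree) ,
                           λ e → spanWith-cong agree (Equivalence.to cols⇔ cols e))
    (λ (ind , w∉ , cols) → independent-cong (sym ∘ agree) ind , w∉ ∘ span-cong agree ,
                           Equivalence.from cols⇔ (λ e → spanWith-cong (sym ∘ agree) (cols e)))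
    where
    agree : ∀ {e} → e ∈ Z → A e ≡ addCol A a b e
    agree = addCol-outside {A = A} a∉Z
    cols⇔ : (∀ e → SpanWith A Z (A a ⊕ A b) (A e)) ⇔ (∀ e → SpanWith A Z (A a ⊕ A b) (addCol A a b e))
    cols⇔ = columns-addCol⇔ {S = SpanWith A Z (A a ⊕ A b)} a≢b spanWith-⊕

  columnBasis-addCol-inside : ∀ {X} → a ∈ X →
    IsColumnBasis (addCol A a b) X ⇔ BasisWith A (X [ a ]≔ false) (A a ⊕ A b)
  columnBasis-addCol-inside {X} a∈X = begin
    IsColumnBasis (addCol A a b) X              ≈⟨ columnBasis-remove⇔ (addCol A a b) a∈X ⟩
    BasisWith (addCol A a b) Z (addCol A a b a) ≡⟨ cong (BasisWith (addCol A a b) Z) (addCol-self {A = A}) ⟩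
    BasisWith (addCol A a b) Z (A a ⊕ A b)      ≈⟨ basisWith-addCol (∉-remove X a) ⟨
    BasisWith A Z (A a ⊕ A b)                   ∎
    where
    open ⇔-Reasoning
    Z = X [ a ]≔ false

  columnBasis-addCol-both : ∀ {X} → a ∈ X → b ∈ X → IsColumnBasis A X ⇔ IsColumnBasis (addCol A a b) X
  columnBasis-addCol-both {X} a∈X b∈X = begin
    IsColumnBasis A X               ≈⟨ columnBasis-remove⇔ A a∈X ⟩
    BasisWith A Z (A a)             ≈⟨ mk⇔ (basisWith-shift b∈span) unshift ⟩
    BasisWith A Z (A a ⊕ A b)       ≈⟨ columnBasis-addCol-inside a∈X ⟨
    IsColumnBasis (addCol A a b) X  ∎
    where
    open ⇔-Reasoning
    Z = X [ a ]≔ false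
    b∈span : Span A Z (A b)
    b∈span = span-column (∈-update⁺ false (a≢b ∘ sym) b∈X)
    unshift : BasisWith A Z (A a ⊕ A b) → BasisWith A Z (A a)
    unshift q = subst (BasisWith A Z) (⊕-cancelʳ (A a) (A b)) (basisWith-shift b∈span q)

Represents : SetSystem n → Matrix n k → Set
Represents B A = ∀ X → (B X ≡ true) ⇔ IsColumnBasis A X

slide-represents : ∀ {B : SetSystem n} {A : Matrix n k} {a b} → a ≢ b →
  Represents B A → Represents (handleSlide B a b) (addCol A a b)
slide-represents {B = B} {A} {a} {b} a≢b rep X with lookup X a in ea | lookup X b in eb
... | false | _ = begin
  (B X xor false ≡ true)          ≡⟨ cong (_≡ true) (xor-identityʳ (B X)) ⟩
  (B X ≡ true)                    ≈⟨ rep X ⟩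
  IsColumnBasis A X               ≈⟨ columnBasis-addCol-outside a≢b (λ a∈X → false≢true (trans (sym ea) ([]=⇒lookup a∈X))) ⟩
  IsColumnBasis (addCol A a b) X  ∎
  where open ⇔-Reasoning
... | true | true = begin
  (B X xor false ≡ true)          ≡⟨ cong (_≡ true) (xor-identityʳ (B X)) ⟩
  (B X ≡ true)                    ≈⟨ rep X ⟩
  IsColumnBasis A X               ≈⟨ columnBasis-addCol-both a≢b (lookup⇒[]= a X ea) (lookup⇒[]= b X eb) ⟩
  IsColumnBasis (addCol A a b) X  ∎
  where open ⇔-Reasoning
... | true | false = begin
  (B X xor B (Z [ b ]≔ true) ≡ true)
    ≈⟨ xor-true⇔ (⇔-trans (rep X) (columnBasis-remove⇔ A a∈X)) (⇔-trans (rep _) (columnBasis-insert⇔ A b∉Z)) ⟩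
  (BasisWith A Z (A a) ⊻ BasisWith A Z (A b))
    ≈⟨ basisWith-⊕ a b ⟨
  BasisWith A Z (A a ⊕ A b)
    ≈⟨ columnBasis-addCol-inside a≢b a∈X ⟨
  IsColumnBasis (addCol A a b) X  ∎
  where
  open ⇔-Reasoning
  Z = X [ a ]≔ false
  a∈X : a ∈ X
  a∈X = lookup⇒[]= a X ea
  b∉Z : b ∉ Z
  b∉Z b∈Z = false≢true (trans (sym eb) ([]=⇒lookup (∈-update⁻ false (a≢b ∘ sym) b∈Z)))

applyAddCols : Matrix n k → List (Slide n) → Matrix n k
applyAddCols = foldl λ { A ((a , b) , _) → addCol A a b }

slides-represent : ∀ {B : SetSystem n} {A : Matrix n k} (σ : List (Slide n)) →
  Represents B A → Represents (applySlides B σ) (applyAddCols A σ)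
slides-represent []                     rep = rep
slides-represent (((a , b) , a≢b) ∷ σ) rep = slides-represent σ (slide-represents a≢b rep)

columnBasis-cong : ∀ {A A′ : Matrix n k} {X} → A ≗ A′ → IsColumnBasis A X → IsColumnBasis A′ X
columnBasis-cong {A′ = A′} {X} A≗A′ (ind , sp) =
  independent-cong agree ind , λ e → subst (Span A′ X) (A≗A′ e) (span-cong agree (sp e))
  where
  agree : ∀ {e} → e ∈ X → _
  agree {e} _ = A≗A′ e

represents-cong : ∀ {B : SetSystem n} {A A′ : Matrix n k} → A ≗ A′ → Represents B A → Represents B A′
represents-cong A≗A′ rep X = ⇔-trans (rep X)
  (mk⇔ (columnBasis-cong A≗A′) (columnBasis-cong (sym ∘ A≗A′)))

-- Clearing the columns outside a basis

applyAddCols-cong : ∀ {A A′ : Matrix n k} (σ : List (Slide n)) → A ≗ A′ → applyAddCols A σ ≗ applyAddCols A′ σ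
applyAddCols-cong []                   A≗A′ = A≗A′
applyAddCols-cong (((a , b) , _) ∷ σ) A≗A′ = applyAddCols-cong σ (addCol-cong A≗A′)

_↝_ : Matrix n k → Matrix n k → Set
_↝_ {n} A M = Σ (List (Slide n)) λ σ → applyAddCols A σ ≗ M

↝-addCol : ∀ {A : Matrix n k} {a b} → a ≢ b → A ↝ addCol A a b
↝-addCol a≢b = (_ , a≢b) ∷ [] , λ _ → refl

↝-respʳ : ∀ {A M N : Matrix n k} → A ↝ M → M ≗ N → A ↝ N
↝-respʳ (σ , eq) M≗N = σ , λ e → trans (eq e) (M≗N e)

↝-trans : ∀ {A M N : Matrix n k} → A ↝ M → M ↝ N → A ↝ N
↝-trans {A = A} (σ , eqσ) (τ , eqτ) = σ ++ τ , λ e →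
  trans (cong (λ C → C e) (foldl-++ _ A σ τ)) (trans (applyAddCols-cong τ eqσ e) (eqτ e))

elements : Subset n → List (Fin n)
elements []          = []
elements (true ∷ Y)  = zero ∷ List.map suc (elements Y)
elements (false ∷ Y) = List.map suc (elements Y)

elements-∈ : (Y : Subset n) → All (_∈ Y) (elements Y)
elements-∈ []          = []
elements-∈ (true ∷ Y)  = here ∷ All.map⁺ (All.map there (elements-∈ Y))
elements-∈ (false ∷ Y) = All.map⁺ (All.map there (elements-∈ Y))

sumList : Matrix n k → List (Fin n) → GF2Vec k
sumList A = foldr (λ e → A e ⊕_) zeroVec

sumCols-elements : (A : Matrix n k) (Y : Subset n) → sumCols A Y ≡ sumList A (elements Y)
sumCols-elements A []          = refl
sumCols-elements A (true ∷ Y)  =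
  cong (A zero ⊕_) (trans (sumCols-elements (A ∘ suc) Y) (sym (foldr-map _ suc zeroVec (elements Y))))
sumCols-elements A (false ∷ Y) =
  trans (sumCols-elements (A ∘ suc) Y) (sym (foldr-map _ suc zeroVec (elements Y)))

↝-addColumns : ∀ (A : Matrix n k) e {L} → All (e ≢_) L → A ↝ updateAt A e (_⊕ sumList A L)
↝-addColumns A e []                    = [] , λ x → sym (updateAt-id-local e A (⊕-identityʳ (A e)) x)
↝-addColumns A e {f ∷ L} (e≢f ∷ e∉L) =
  ↝-respʳ (↝-trans (↝-addColumns A e e∉L) (↝-addCol e≢f)) (updateAt-updateAt-local e A (begin
    (A e ⊕ sumList A L) ⊕ M f   ≡⟨ cong ((A e ⊕ sumList A L) ⊕_) (updateAt-minimal f e A (e≢f ∘ sym)) ⟩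
    (A e ⊕ sumList A L) ⊕ A f   ≡⟨ ⊕-assoc (A e) (sumList A L) (A f) ⟩
    A e ⊕ (sumList A L ⊕ A f)   ≡⟨ cong (A e ⊕_) (⊕-comm (sumList A L) (A f)) ⟩
    A e ⊕ (A f ⊕ sumList A L)   ∎))
  where
  open ≡-Reasoning
  M = updateAt A e (_⊕ sumList A L)

record Anchored (A : Matrix n k) (F : Subset n) (C : Matrix n k) : Set where
  field
    agrees  : ∀ {f} → f ∈ F → C f ≡ A f
    spanned : ∀ e → Span A F (C e)

module _ {A : Matrix n k} {F : Subset n} where

  anchored-refl : IsColumnBasis A F → Anchored A F A
  anchored-refl (_ , sp) = record { agrees = λ _ → refl ; spanned = sp }

  module _ {C : Matrix n k} (anc : Anchored A F C) {e : Fin n} (e∉F : e ∉ F) where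
    open Anchored anc

    ↝-clearColumn : C ↝ updateAt C e (λ _ → zeroVec)
    ↝-clearColumn with spanned e
    ... | Y , Y⊆F , eq = ↝-respʳ (↝-addColumns C e (All.map e≢ (elements-∈ Y))) (updateAt-cong-local e C (begin
      C e ⊕ sumList C (elements Y)   ≡⟨ cong (C e ⊕_) (sym (sumCols-elements C Y)) ⟩
      C e ⊕ sumCols C Y              ≡⟨ cong (C e ⊕_) (sumCols-cong Y (agrees ∘ Y⊆F)) ⟩
      C e ⊕ sumCols A Y              ≡⟨ cong (C e ⊕_) eq ⟩
      C e ⊕ C e                      ≡⟨ ⊕-self (C e) ⟩
      zeroVec                        ∎))
      where
      open ≡-Reasoning
      e≢ : ∀ {y} → y ∈ Y → e ≢ y
      e≢ y∈Y refl = e∉F (Y⊆F y∈Y)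

    anchored-clear : Anchored A F (updateAt C e (λ _ → zeroVec))
    anchored-clear = record
      { agrees  = λ {f} f∈F → trans (updateAt-minimal f e C λ { refl → e∉F f∈F }) (agrees f∈F)
      ; spanned = spanned′
      }
      where
      spanned′ : ∀ x → Span A F (updateAt C e (λ _ → zeroVec) x)
      spanned′ x with x ≟ e
      ... | yes refl = subst (Span A F) (sym (updateAt-updates e C)) span-zero
      ... | no  x≢e  = subst (Span A F) (sym (updateAt-minimal x e C x≢e)) (spanned x)

  clear-columns : ∀ (es : List (Fin n)) {C} → Anchored A F C →
    ∃ λ M → C ↝ M × Anchored A F M × (∀ {x} → x ∈ˡ es → x ∉ F → M x ≡ zeroVec)
  clear-columns []       anc = _ , ([] , λ _ → refl) , anc , λ ()
  clear-columns (e ∷ es) anc with clear-columns es anc | e ∈? F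
  ... | M , C↝M , ancM , zeros | yes e∈F = M , C↝M , ancM , λ
    { (here refl) e∉F → ⊥-elim (e∉F e∈F)
    ; (there x∈es)    → zeros x∈es }
  ... | M , C↝M , ancM , zeros | no  e∉F =
    _ , ↝-trans C↝M (↝-clearColumn ancM e∉F) , anchored-clear ancM e∉F , zeros′
    where
    zeros′ : ∀ {x} → x ∈ˡ e ∷ es → x ∉ F → updateAt M e (λ _ → zeroVec) x ≡ zeroVec
    zeros′ {x} x∈ x∉F with x ≟ e | x∈
    ... | yes refl | _          = updateAt-updates e M
    ... | no  x≢e  | here x≡e   = ⊥-elim (x≢e x≡e)
    ... | no  x≢e  | there x∈es = trans (updateAt-minimal x e M x≢e) (zeros x∈es x∉F)

module _ {A M : Matrix n k} {F : Subset n} (F-basis : IsColumnBasis A F)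
         (agrees : ∀ {f} → f ∈ F → M f ≡ A f) (zeros : ∀ {e} → e ∉ F → M e ≡ zeroVec) where

  columnBasis-unique : ∀ X → IsColumnBasis M X ⇔ X ≡ F
  columnBasis-unique X = mk⇔ unique λ { refl → F-basisᴹ }
    where
    F-basisᴹ : IsColumnBasis M F
    F-basisᴹ = independent-cong (sym ∘ agrees) (proj₁ F-basis) , spanned
      where
      spanned : Spanning M F
      spanned e with e ∈? F
      ... | yes e∈F = span-column e∈F
      ... | no  e∉F = subst (Span M F) (sym (zeros e∉F)) span-zero
    unique : IsColumnBasis M X → X ≡ F
    unique (ind , sp) = ⊆-antisym X⊆F (spanning-⊆-independent⇒⊇ (proj₁ F-basisᴹ) X⊆F sp)
      where
      X⊆F : X ⊆ F
      X⊆F {x} x∈X with x ∈? F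
      ... | yes x∈F = x∈F
      ... | no  x∉F = ⊥-elim (independent-nonzero ind x∈X (zeros x∉F))

proposition1 : (n : ℕ) (B : SetSystem n) → IsBinaryMatroid B →
    (F : Subset n) → B F ≡ true →
    (∀ F' → B F' ≡ true → lengthWrt F F' ≤ 2) →
    Σ (List (Slide n)) λ σ → SingleSet (applySlides B σ)
proposition1 n B (k , A , rep) F F∈B _ =
  let F-basis                      = Equivalence.to (rep F) F∈B
      M , (σ , A↝M) , anc , zeros = clear-columns (allFin n) (anchored-refl F-basis)
  in  σ , F , λ X → ⇔-trans (represents-cong A↝M (slides-represent σ rep) X)
                            (columnBasis-unique F-basis (Anchored.agrees anc) (zeros (∈-allFin _)) X)
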